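{- Let $G$ be a finite simple connected graph. Then $Mc(G)=\sigma^{\square}_V(G)$, where $$Mc(G)=\max_{l}\ \max\{m_G(f,g): (f,g) \text{ a pair of opposite lazy } l\text{ -tracks on } G\},$$ the outer maximum running over all $l\in\mathbb{N}$ for which a pair of opposite lazy $l$-tracks on $G$ exists.
   Context: $G$ is a finite simple connected graph with distance $d_G$. For $l\in\mathbb{N}$, $\mathbb{N}_l=\{1,\dots,l\}$. A lazy $l$-track on $G$ is a surjective $f:\mathbb{N}_l\to V(G)$ such that for each $i\in\{1,\dots,l-1\}$, $f(i)f(i+1)\in E(G)$ or $f(i)=f(i+1)$. Lazy $l$-tracks $f,g$ are opposite if for every $i\in\{1,\dots,l-1\}$, either ($f(i)f(i+1)\in E(G)$ and $g(i)=g(i+1)$) or ($g(i)g(i+1)\in E(G)$ and $f(i)=f(i+1)$). For $f,g:\mathbb{N}_l\to V(G)$, $m_G(f,g)=\min\{d_G(f(i),g(i)):i\in\mathbb{N}_l\}$. The Cartesian product $G\square G$ has vertex set $V(G)\times V(G)$, with $(u,v),(u',v')$ adjacent iff ($u=u'$ and $vv'\in E(G)$) or ($v=v'$ and $uu'\in E(G)$). For a graph $H$ with $V(H)\subseteq V(G)\times V(G)$, $\varepsilon_G(H)=\min\{d_G(u,v):(u,v)\in V(H)\}$, and $p_1,p_2$ denote the coordinate projections. The Cartesian vertex span of $G$ (Banič–Taranenko) is $\sigma^{\square}_V(G)=\max\{\varepsilon_G(H): H \text{ a connected subgraph of } G\square G \text{ with } p_1(V(H))=p_2(V(H))=V(G)\}$.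 -}

module Defs where

open import Data.Nat using (ℕ; zero; suc; _≤_)
open import Data.Fin using (Fin; toℕ)
open import Data.Bool using (Bool; true)
open import Data.Product using (Σ; ∃; _×_; _,_; proj₁; proj₂)
open import Data.Sum using (_⊎_)
open import Relation.Nullary using (¬_; Dec)
open import Relation.Binary.PropositionalEquality using (_≡_)

record Graph : Set₁ where
  field
    n     : ℕ
    Adj   : Fin n → Fin n → Set
    adj?  : ∀ u v → Dec (Adj u v)
    sym   : ∀ {u v} → Adj u v → Adj v u
    irrefl : ∀ {u} → ¬ Adj u u

module _ (G : Graph) where
  open Graph G

  V : Set
  V = Fin n

  data Walk : V → V → ℕ → Set where
    here : ∀ {u} → Walk u u zero
    step : ∀ {u w v k} → Adj u w → Walk w v k → Walk u v (suc k)

  Connected : Set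
  Connected = ∀ u v → ∃ λ k → Walk u v k

  Dist : V → V → ℕ → Set
  Dist u v d = Walk u v d × (∀ k → Walk u v k → d ≤ k)

  Surjective : ∀ {l} → (Fin l → V) → Set
  Surjective {l} f = ∀ v → ∃ λ (i : Fin l) → f i ≡ v

  Consec : ∀ {l} → Fin l → Fin l → Set
  Consec i j = toℕ j ≡ suc (toℕ i)

  LazyTrack : (l : ℕ) → (Fin l → V) → Set
  LazyTrack l f = Surjective f ×
    (∀ i j → Consec i j → Adj (f i) (f j) ⊎ f i ≡ f j)

  Opposite : (l : ℕ) → (Fin l → V) → (Fin l → V) → Set
  Opposite l f g = ∀ i j → Consec i j →
    (Adj (f i) (f j) × g i ≡ g j) ⊎ (Adj (g i) (g j) × f i ≡ f j)

  MinDist : (l : ℕ) → (Fin l → V) → (Fin l → V) → ℕ → Set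
  MinDist l f g m = (∃ λ i → Dist (f i) (g i) m) ×
    (∀ i d → Dist (f i) (g i) d → m ≤ d)

  OppositePair : (l : ℕ) → (Fin l → V) → (Fin l → V) → Set
  OppositePair l f g = LazyTrack l f × LazyTrack l g × Opposite l f g

  IsMc : ℕ → Set
  IsMc M =
    (∃ λ l → Σ (Fin l → V) λ f → Σ (Fin l → V) λ g →
       OppositePair l f g × MinDist l f g M) ×
    (∀ l (f g : Fin l → V) m → OppositePair l f g → MinDist l f g m → m ≤ M)

  ProdAdj : V × V → V × V → Set
  ProdAdj (u , v) (u' , v') = (u ≡ u' × Adj v v') ⊎ (v ≡ v' × Adj u u')

  record SubProd : Set where
    field
      VH  : V × V → Bool
      EH  : V × V → V × V → Bool
      EH-sym  : ∀ x y → EH x y ≡ true → EH y x ≡ true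
      EH-ends : ∀ x y → EH x y ≡ true → VH x ≡ true × VH y ≡ true
      EH-adj  : ∀ x y → EH x y ≡ true → ProdAdj x y

  module _ (H : SubProd) where
    open SubProd H

    data WalkH : V × V → V × V → Set where
      hereH : ∀ {x} → WalkH x x
      stepH : ∀ {x y z} → EH x y ≡ true → WalkH y z → WalkH x z

    ConnectedH : Set
    ConnectedH = ∀ x y → VH x ≡ true → VH y ≡ true → WalkH x y

    ProjSurj : Set
    ProjSurj = (∀ u → ∃ λ v → VH (u , v) ≡ true) ×
               (∀ v → ∃ λ u → VH (u , v) ≡ true)

    Eps : ℕ → Set
    Eps e = (∃ λ x → VH x ≡ true × Dist (proj₁ x) (proj₂ x) e) ×
            (∀ x d → VH x ≡ true → Dist (proj₁ x) (proj₂ x) d → e ≤ d)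

  Admissible : SubProd → Set
  Admissible H = ConnectedH H × ProjSurj H

  IsSpan : ℕ → Set
  IsSpan s = (Σ SubProd λ H → Admissible H × Eps H s) ×
             (∀ H e → Admissible H → Eps H e → e ≤ s)

-- Call a pair (u , v) of vertices k-far if d(u , v) ≥ k, and let the level-k graph be
-- the subgraph of G □ G induced on the k-far pairs.  Two opposite lazy tracks are the
-- coordinates of a walk in G □ G, and a connected subgraph H lies in a single component
-- of the level-k graph for k = ε(H); conversely a component is a connected subgraph, and
-- a closed walk through all of its vertices yields a pair of opposite tracks.  So Mc(G)
-- and σ(G) both equal the largest k for which some component at level k projects onto
-- V(G) in both coordinates.  At that k the component contains a pair at distance exactly
-- k, for otherwise it would also be a component at level k + 1.  Reachability in the
-- finite graph G □ G is decidable, which makes this largest k computable.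
module Submission where

open import Defs
open import Data.Bool using (true)
open import Data.Nat using (ℕ; zero; suc; _≤_; _<_; _≤?_; z≤n; s≤s⁻¹; _⊔_)
open import Data.Nat.Properties
  using (suc-injective; ≮⇒≥; ≤∧≢⇒<; ≤-antisym; ≤-trans; ≤-reflexive; n≮n; m≤m⊔n; m≤n⊔m;
         anyUpTo?)
  renaming (_≟_ to _≟ℕ_)
open import Data.Nat.Induction using (<-rec)
open import Data.Fin using (Fin; zero; suc; toℕ; _≟_)
open import Data.Fin.Properties using (any?; all?; *↔×)
open import Data.Fin.Subset using (Subset; _∈_; _∉_; _⊆_; _⊃_; ⁅_⁆; _∪_)
open import Data.Fin.Subset.Properties
  using (_∈?_; x∈⁅x⁆; x∈⁅y⁆⇒x≡y; q⊆p∪q; x∈p∪q⁺; x∈p∪q⁻)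
open import Data.Fin.Subset.Induction using (⊃-wellFounded)
open import Data.List using (List; []; _∷_; lookup)
open import Data.List.Membership.Propositional using () renaming (_∈_ to _∈ₗ_)
open import Data.List.Membership.Propositional.Properties using (∈-lookup)
open import Data.List.Relation.Unary.Any using (here; there; index)
open import Data.List.Relation.Unary.Any.Properties using (lookup-index)
open import Data.Product using (Σ; ∃; _×_; _,_; proj₁; proj₂; swap; map₂)
open import Data.Sum using (_⊎_; inj₁; inj₂; [_,_]; map)
open import Function using (id; _∘_; _on_)
open import Function.Bundles using (_↔_; Inverse)
open import Function.Properties.Inverse using (↔-sym)
open import Induction.WellFounded using (Acc; acc)
open import Level using (Level; 0ℓ)
open import Relation.Binary using (Rel; Decidable; Symmetric)
open import Relation.Binary.Construct.Closure.ReflexiveTransitive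
  using (Star; ε; _◅_; _◅◅_; gmap; reverse; return) renaming (map to Star-map)
open import Relation.Nullary using (Dec; yes; no; does; ¬?; contradiction)
open import Relation.Nullary.Decidable using (_×-dec_; _⊎-dec_; map′; dec-true; decidable-stable)
open import Relation.Binary.PropositionalEquality using (_≡_; refl; sym; trans; cong; subst; subst₂)
import Relation.Unary as U

private
  variable
    a ℓ p : Level
    A : Set a

Least : U.Pred ℕ p → U.Pred ℕ p
Least P d = P d × (∀ j → P j → d ≤ j)

Greatest : U.Pred ℕ p → U.Pred ℕ p
Greatest P M = P M × (∀ j → P j → j ≤ M)

Least-unique : ∀ {P : U.Pred ℕ p} {d d′} → Least P d → Least P d′ → d ≡ d′
Least-unique (pd , min) (pd′ , min′) = ≤-antisym (min _ pd′) (min′ _ pd)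

module _ {P : U.Pred ℕ p} (P? : U.Decidable P) where

  least : ∀ {k} → P k → ∃ (Least P)
  least {k} = <-rec (λ k → P k → ∃ (Least P)) search k
    where
    search : ∀ k → (∀ {j} → j < k → P j → ∃ (Least P)) → P k → ∃ (Least P)
    search k smaller pk with anyUpTo? P? k
    ... | yes (j , j<k , pj) = smaller j<k pj
    ... | no ∄j = k , pk , λ j pj → ≮⇒≥ λ j<k → ∄j (j , j<k , pj)

  greatest : ∀ b → P 0 → (∀ j → P j → j ≤ b) → ∃ (Greatest P)
  greatest b p0 bounded with P? b
  ... | yes pb = b , pb , bounded
  greatest zero    p0 bounded | no ¬pb = contradiction p0 ¬pb
  greatest (suc b) p0 bounded | no ¬pb =
    greatest b p0 λ j pj → s≤s⁻¹ (≤∧≢⇒< (bounded j pj) λ { refl → ¬pb pj })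

Chained : Rel A ℓ → ∀ {l} → (Fin l → A) → Set ℓ
Chained R h = ∀ i j → toℕ j ≡ suc (toℕ i) → R (h i) (h j)

module _ {R : Rel A ℓ} where

  Chained⇒Star : ∀ {l} (h : Fin (suc l) → A) → Chained R h → ∀ i → Star R (h zero) (h i)
  Chained⇒Star h chain zero = ε
  Chained⇒Star {suc l} h chain (suc i) =
    chain zero (suc zero) refl ◅
    Chained⇒Star (λ i → h (suc i)) (λ i j c → chain (suc i) (suc j) (cong suc c)) i

  -- Split in two so that vertices w is a cons cell even when w is a variable.
  vertices : ∀ {x y} → Star R x y → List A
  vertices-after : ∀ {x y} → Star R x y → List A

  vertices {x} w = x ∷ vertices-after w

  vertices-after ε       = []
  vertices-after (_ ◅ w) = vertices w

  vertices-chained : ∀ {x y} (w : Star R x y) → Chained R (lookup (vertices w))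
  vertices-chained (r ◅ w) zero    (suc zero)    _ = r
  vertices-chained (_ ◅ w) (suc i) (suc j)       c = vertices-chained w i j (suc-injective c)
  vertices-chained (_ ◅ _) zero    (suc (suc _)) ()
  vertices-chained _       zero    zero          ()
  vertices-chained _       (suc _) zero          ()

  end∈vertices : ∀ {x y} (w : Star R x y) → y ∈ₗ vertices w
  end∈vertices ε       = here refl
  end∈vertices (_ ◅ w) = there (end∈vertices w)

  ∈-vertices-◅◅ˡ : ∀ {x y z t} (w : Star R x y) (w′ : Star R y z) →
                   t ∈ₗ vertices w → t ∈ₗ vertices (w ◅◅ w′)
  ∈-vertices-◅◅ˡ _       w′ (here t≡x)  = here t≡x
  ∈-vertices-◅◅ˡ (_ ◅ w) w′ (there t∈w) = there (∈-vertices-◅◅ˡ w w′ t∈w)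

  ∈-vertices-◅◅ʳ : ∀ {x y z t} (w : Star R x y) (w′ : Star R y z) →
                   t ∈ₗ vertices w′ → t ∈ₗ vertices (w ◅◅ w′)
  ∈-vertices-◅◅ʳ ε       w′ t∈w′ = t∈w′
  ∈-vertices-◅◅ʳ (_ ◅ w) w′ t∈w′ = there (∈-vertices-◅◅ʳ w w′ t∈w′)

  ∈-vertices⇒Star : ∀ {x y t} (w : Star R x y) → t ∈ₗ vertices w → Star R x t
  ∈-vertices⇒Star _       (here refl)  = ε
  ∈-vertices⇒Star (r ◅ w) (there t∈w) = r ◅ ∈-vertices⇒Star w t∈w

  module _ (R-sym : Symmetric R) (star? : Decidable (Star R)) (x : A) where

    tour : ∀ {k} (t : Fin k → A) →
           Σ (Star R x x) λ w → ∀ i → Star R x (t i) → t i ∈ₗ vertices w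
    tour {zero}  t = ε , λ ()
    tour {suc k} t with tour (λ i → t (suc i)) | star? x (t zero)
    ... | w , visits | no ¬reach =
      w , λ { zero r → contradiction r ¬reach ; (suc i) r → visits i r }
    ... | w , visits | yes r₀ = (r₀ ◅◅ reverse R-sym r₀) ◅◅ w , λ
      { zero _    → ∈-vertices-◅◅ˡ (r₀ ◅◅ _) w (∈-vertices-◅◅ˡ r₀ _ (end∈vertices r₀))
      ; (suc i) r → ∈-vertices-◅◅ʳ (r₀ ◅◅ _) w (visits i r) }

module _ {m} {R : Rel (Fin m) ℓ} (R? : Decidable R) where

  ReachClosed : Fin m → Subset m → Set ℓ
  ReachClosed x T = (∀ {y} → y ∈ T → Star R x y) × (∀ {y z} → y ∈ T → R y z → z ∈ T)

  ⁅z⁆∪S⊃S : ∀ {z : Fin m} {S} → z ∉ S → (⁅ z ⁆ ∪ S) ⊃ S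
  ⁅z⁆∪S⊃S {z} {S} z∉S = q⊆p∪q ⁅ z ⁆ S , z , x∈p∪q⁺ (inj₁ (x∈⁅x⁆ z)) , z∉S

  grow : ∀ {x} S → Acc _⊃_ S → (∀ {y} → y ∈ S → Star R x y) →
         Σ (Subset m) λ T → S ⊆ T × ReachClosed x T
  grow {x} S (acc larger) reachS
    with any? (λ z → ¬? (z ∈? S) ×-dec any? λ y → (y ∈? S) ×-dec R? y z)
  ... | no noFrontier = S , id , reachS , λ {y} {z} y∈S yRz →
        decidable-stable (z ∈? S) λ z∉S → noFrontier (z , z∉S , y , y∈S , yRz)
  ... | yes (z , z∉S , y , y∈S , yRz) =
        let T , S′⊆T , closedT = grow (⁅ z ⁆ ∪ S) (larger (⁅z⁆∪S⊃S z∉S)) reachS′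
        in T , S′⊆T ∘ q⊆p∪q ⁅ z ⁆ S , closedT
    where
    reachS′ : ∀ {t} → t ∈ ⁅ z ⁆ ∪ S → Star R x t
    reachS′ t∈S′ with x∈p∪q⁻ ⁅ z ⁆ S t∈S′
    ... | inj₁ t∈⁅z⁆ rewrite x∈⁅y⁆⇒x≡y z t∈⁅z⁆ = reachS y∈S ◅◅ return yRz
    ... | inj₂ t∈S = reachS t∈S

  Star-closed : ∀ {T : Subset m} {s t} →
                (∀ {y z} → y ∈ T → R y z → z ∈ T) → s ∈ T → Star R s t → t ∈ T
  Star-closed closed s∈T ε       = s∈T
  Star-closed closed s∈T (r ◅ w) = Star-closed closed (closed s∈T r) w

  closure : ∀ x → Σ (Subset m) λ T → x ∈ T × ReachClosed x T
  closure x
    with grow ⁅ x ⁆ (⊃-wellFounded ⁅ x ⁆) (λ t∈⁅x⁆ → subst (Star R x) (sym (x∈⁅y⁆⇒x≡y x t∈⁅x⁆)) ε)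
  ... | T , ⁅x⁆⊆T , closedT = T , ⁅x⁆⊆T (x∈⁅x⁆ x) , closedT

  star?-Fin : Decidable (Star R)
  star?-Fin x y with closure x
  ... | T , x∈T , reach , closed = map′ reach (Star-closed closed x∈T) (y ∈? T)

bounded-Fin : ∀ {m} (f : Fin m → ℕ) → ∃ λ B → ∀ i → f i ≤ B
bounded-Fin {zero}  f = 0 , λ ()
bounded-Fin {suc m} f with bounded-Fin (λ i → f (suc i))
... | B , f≤B =
  f zero ⊔ B , λ { zero → m≤m⊔n (f zero) B ; (suc i) → ≤-trans (f≤B i) (m≤n⊔m (f zero) B) }

module Enumerated {m} (enum : A ↔ Fin m) where
  open Inverse enum using (to; from; strictlyInverseʳ)

  star? : {R : Rel A ℓ} → Decidable R → Decidable (Star R)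
  star? {R = R} R? x y = map′ pull push (star?-Fin (λ i j → R? (from i) (from j)) (to x) (to y))
    where
    pull : Star (R on from) (to x) (to y) → Star R x y
    pull w = subst₂ (Star R) (strictlyInverseʳ x) (strictlyInverseʳ y) (gmap from id w)
    push : Star R x y → Star (R on from) (to x) (to y)
    push = gmap to (subst₂ R (sym (strictlyInverseʳ _)) (sym (strictlyInverseʳ _)))

  ∃? : {P : U.Pred A p} → U.Decidable P → Dec (∃ P)
  ∃? {P = P} P? =
    map′ (λ (i , pi) → from i , pi) (λ (x , px) → to x , subst P (sym (strictlyInverseʳ x)) px)
         (any? λ i → P? (from i))

  bounded : (f : A → ℕ) → ∃ λ B → ∀ x → f x ≤ B
  bounded f with bounded-Fin (λ i → f (from i))
  ... | B , f≤B = B , λ x → subst (λ y → f y ≤ B) (strictlyInverseʳ x) (f≤B (to x))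

  full-tour : {R : Rel A ℓ} → Symmetric R → Decidable R → ∀ x →
              Σ (Star R x x) λ w → ∀ {y} → Star R x y → y ∈ₗ vertices w
  full-tour {R = R} R-sym R? x with tour R-sym (star? R?) x from
  ... | w , visits = w , λ {y} r → subst (_∈ₗ vertices w) (strictlyInverseʳ y)
                                   (visits (to y) (subst (Star R x) (sym (strictlyInverseʳ y)) r))

dec-true⁻¹ : (a? : Dec A) → does a? ≡ true → A
dec-true⁻¹ (yes a) _ = a
dec-true⁻¹ (no _)  ()

swap-moves : ∀ {a b c d} {A : Set a} {B : Set b} {C : Set c} {D : Set d} →
             (A × B) ⊎ (C × D) → (D × C) ⊎ (B × A)
swap-moves = [ inj₂ ∘ swap , inj₁ ∘ swap ]

module _ (G : Graph) where
  open Graph G using (Adj; adj?) renaming (sym to Adj-sym)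

  Pair : Set
  Pair = V G × V G

  prodAdj? : Decidable (ProdAdj G)
  prodAdj? (u , v) (u′ , v′) = ((u ≟ u′) ×-dec adj? v v′) ⊎-dec ((v ≟ v′) ×-dec adj? u u′)

  prodAdj-sym : Symmetric (ProdAdj G)
  prodAdj-sym {_ , _} {_ , _} (inj₁ (refl , a)) = inj₁ (refl , Adj-sym a)
  prodAdj-sym {_ , _} {_ , _} (inj₂ (refl , a)) = inj₂ (refl , Adj-sym a)

  opposite⇒lazyˡ : ∀ {l f g} → Opposite G l f g →
                   ∀ i j → Consec G i j → Adj (f i) (f j) ⊎ f i ≡ f j
  opposite⇒lazyˡ opp i j c = map proj₁ proj₂ (opp i j c)

  opposite⇒lazyʳ : ∀ {l f g} → Opposite G l f g →
                   ∀ i j → Consec G i j → Adj (g i) (g j) ⊎ g i ≡ g j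
  opposite⇒lazyʳ opp i j c = [ inj₂ ∘ proj₂ , inj₁ ∘ proj₁ ] (opp i j c)

  opposite⇒oppositePair : ∀ {l f g} → Surjective G f → Surjective G g →
                          Opposite G l f g → OppositePair G l f g
  opposite⇒oppositePair f-onto g-onto opp =
    (f-onto , opposite⇒lazyˡ opp) , (g-onto , opposite⇒lazyʳ opp) , opp

  walk? : ∀ u v k → Dec (Walk G u v k)
  walk? u v zero with u ≟ v
  ... | yes refl = yes here
  ... | no u≢v   = no λ { here → u≢v refl }
  walk? u v (suc k) =
    map′ (λ (w , uw , w⇝v) → step uw w⇝v) (λ { (step uw w⇝v) → _ , uw , w⇝v })
         (any? λ w → adj? u w ×-dec walk? w v k)

  liftˡ : ∀ {u u′ k} c → Walk G u u′ k → Star (ProdAdj G) (u , c) (u′ , c)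
  liftˡ c here          = ε
  liftˡ c (step uw w⇝) = inj₂ (refl , uw) ◅ liftˡ c w⇝

  liftʳ : ∀ {v v′ k} c → Walk G v v′ k → Star (ProdAdj G) (c , v) (c , v′)
  liftʳ c here          = ε
  liftʳ c (step vw w⇝) = inj₁ (refl , vw) ◅ liftʳ c w⇝

module Levels (G : Graph) (conn : Connected G) where
  open Graph G using (n)
  open Enumerated (↔-sym (*↔× {n} {n}))

  distance : ∀ u v → ∃ (Dist G u v)
  distance u v = least (walk? G u v) (proj₂ (conn u v))

  δ : Pair G → ℕ
  δ (u , v) = proj₁ (distance u v)

  δ-Dist : ∀ p → Dist G (proj₁ p) (proj₂ p) (δ p)
  δ-Dist (u , v) = proj₂ (distance u v)

  Dist⇒δ : ∀ {u v k} → Dist G u v k → k ≡ δ (u , v)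
  Dist⇒δ d = Least-unique d (δ-Dist _)

  δ≡⇒Dist : ∀ {p k} → δ p ≡ k → Dist G (proj₁ p) (proj₂ p) k
  δ≡⇒Dist {p} refl = δ-Dist p

  ≤δ⇒≤Dist : ∀ {k u v d} → k ≤ δ (u , v) → Dist G u v d → k ≤ d
  ≤δ⇒≤Dist k≤δ d = subst (_ ≤_) (sym (Dist⇒δ d)) k≤δ

  Step : ℕ → Rel (Pair G) 0ℓ
  Step k p q = k ≤ δ p × ProdAdj G p q × k ≤ δ q

  step? : ∀ k → Decidable (Step k)
  step? k p q = (k ≤? δ p) ×-dec prodAdj? G p q ×-dec (k ≤? δ q)

  Step-sym : ∀ {k} → Symmetric (Step k)
  Step-sym (kp , a , kq) = kq , prodAdj-sym G a , kp

  Reach : ℕ → Rel (Pair G) 0ℓ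
  Reach k = Star (Step k)

  reach? : ∀ k → Decidable (Reach k)
  reach? k = star? (step? k)

  Reach-gap : ∀ {k x y} → k ≤ δ x → Reach k x y → k ≤ δ y
  Reach-gap kx ε              = kx
  Reach-gap _  ((_ , _ , ky) ◅ w) = Reach-gap ky w

  Reach-raise : ∀ {k j x y} → (∀ z → Reach k x z → j ≤ δ z) → Reach k x y → Reach j x y
  Reach-raise above ε                = ε
  Reach-raise above (s@(_ , a , _) ◅ w) =
    (above _ ε , a , above _ (return s)) ◅ Reach-raise (λ z r → above z (s ◅ r)) w

  Covers : ℕ → Pair G → Set
  Covers k x = (∀ u → ∃ λ v → Reach k x (u , v)) × (∀ v → ∃ λ u → Reach k x (u , v))

  covers? : ∀ k x → Dec (Covers k x)
  covers? k x = all? (λ u → any? λ v → reach? k x (u , v))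
          ×-dec all? (λ v → any? λ u → reach? k x (u , v))

  Feasible : ℕ → Set
  Feasible k = ∃ λ x → k ≤ δ x × Covers k x

  feasible? : ∀ k → Dec (Feasible k)
  feasible? k = ∃? λ x → (k ≤? δ x) ×-dec covers? k x

  feasible-0 : V G → Feasible 0
  feasible-0 a = (a , a) , z≤n , (λ u → a , lift (liftˡ G a (proj₂ (conn a u))))
                               , (λ v → a , lift (liftʳ G a (proj₂ (conn a v))))
    where
    lift : ∀ {p q} → Star (ProdAdj G) p q → Reach 0 p q
    lift = Star-map (λ adj → z≤n , adj , z≤n)

  greatest-feasible : V G → ∃ (Greatest Feasible)
  greatest-feasible a with bounded δ
  ... | B , δ≤B = greatest feasible? B (feasible-0 a) λ j (x , jx , _) → ≤-trans jx (δ≤B x)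

  Tight : ℕ → Pair G → Set
  Tight k x = k ≤ δ x × Covers k x × ∃ λ y → Reach k x y × δ y ≡ k

  greatest⇒tight : ∀ {M x} → (∀ j → Feasible j → j ≤ M) →
                   M ≤ δ x → Covers M x → Tight M x
  greatest⇒tight {M} {x} maximal Mx covers with ∃? (λ y → reach? M x y ×-dec (δ y ≟ℕ M))
  ... | yes found = Mx , covers , found
  ... | no none   = contradiction (maximal (suc M) (x , above x ε , covers↑)) (n≮n M)
    where
    above : ∀ z → Reach M x z → suc M ≤ δ z
    above z r = ≤∧≢⇒< (Reach-gap Mx r) λ M≡δz → none (z , r , sym M≡δz)
    covers↑ : Covers (suc M) x
    covers↑ = (λ u → map₂ (Reach-raise above) (proj₁ covers u))
            , (λ v → map₂ (Reach-raise above) (proj₂ covers v))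

  opposite⇒feasible : ∀ {l f g m} → OppositePair G l f g → MinDist G l f g m → Feasible m
  opposite⇒feasible {zero}          _ ((() , _) , _)
  opposite⇒feasible {suc l} {f} {g} {m} ((f-onto , _) , (g-onto , _) , opp) (_ , min) =
    (f zero , g zero) , gap zero , coversˡ , coversʳ
    where
    gap : ∀ i → m ≤ δ (f i , g i)
    gap i = min i _ (δ-Dist _)
    reach : ∀ i → Reach m (f zero , g zero) (f i , g i)
    reach = Chained⇒Star (λ i → f i , g i) λ i j c → gap i , swap-moves (opp i j c) , gap j
    coversˡ : ∀ u → ∃ λ v → Reach m (f zero , g zero) (u , v)
    coversˡ u with f-onto u
    ... | i , refl = g i , reach i
    coversʳ : ∀ v → ∃ λ u → Reach m (f zero , g zero) (u , v)
    coversʳ v with g-onto v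
    ... | i , refl = f i , reach i

  admissible⇒feasible : ∀ {H e} → Admissible G H → Eps G H e → Feasible e
  admissible⇒feasible {H} {e} (connected , ontoˡ , ontoʳ) ((x , x∈H , dist-x) , min) =
    x , ≤-reflexive (Dist⇒δ dist-x) , (λ u → map₂ reach (ontoˡ u)) , λ v → map₂ reach (ontoʳ v)
    where
    open SubProd H
    gap : ∀ {y} → VH y ≡ true → e ≤ δ y
    gap {y} y∈H = min y (δ y) y∈H (δ-Dist y)
    walk⇒reach : ∀ {y z} → VH y ≡ true → WalkH G H y z → Reach e y z
    walk⇒reach _   hereH          = ε
    walk⇒reach y∈H (stepH yz∈H w) =
      let _ , z∈H = EH-ends _ _ yz∈H
      in (gap y∈H , EH-adj _ _ yz∈H , gap z∈H) ◅ walk⇒reach z∈H w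
    reach : ∀ {y} → VH y ≡ true → Reach e x y
    reach y∈H = walk⇒reach x∈H (connected x _ x∈H y∈H)

  tight⇒opposite : ∀ {k x} → Tight k x →
    ∃ λ l → Σ (Fin l → V G) λ f → Σ (Fin l → V G) λ g →
      OppositePair G l f g × MinDist G l f g k
  tight⇒opposite {k} {x} (kx , (ontoˡ , ontoʳ) , y , x⇝y , δy≡k)
    with full-tour Step-sym (step? k) x
  ... | w , visits = _ , f , g , opposite⇒oppositePair G f-onto g-onto opp , min-dist
    where
    h : Fin _ → Pair G
    h = lookup (vertices w)
    f g : Fin _ → V G
    f = proj₁ ∘ h
    g = proj₂ ∘ h
    opp : Opposite G _ f g
    opp i j c = swap-moves (proj₁ (proj₂ (vertices-chained w i j c)))
    position : ∀ {z} → Reach k x z → ∃ λ i → h i ≡ z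
    position r = index (visits r) , sym (lookup-index (visits r))
    f-onto : Surjective G f
    f-onto u = map₂ (cong proj₁) (position (proj₂ (ontoˡ u)))
    g-onto : Surjective G g
    g-onto v = map₂ (cong proj₂) (position (proj₂ (ontoʳ v)))
    gap : ∀ i → k ≤ δ (h i)
    gap i = Reach-gap kx (∈-vertices⇒Star w (∈-lookup i))
    min-dist : MinDist G _ f g k
    min-dist = map₂ (λ hi≡y → δ≡⇒Dist (trans (cong δ hi≡y) δy≡k)) (position x⇝y)
             , λ i _ → ≤δ⇒≤Dist (gap i)

  component : ℕ → Pair G → SubProd G
  component k x = record
    { VH      = λ y → does (reach? k x y)
    ; EH      = λ y z → does (edge? y z)
    ; EH-sym  = λ y z yz → let x⇝y , s = dec-true⁻¹ (edge? y z) yz in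
                           dec-true (edge? z y) (x⇝y ◅◅ return s , Step-sym s)
    ; EH-ends = λ y z yz → let x⇝y , s = dec-true⁻¹ (edge? y z) yz in
                           dec-true (reach? k x y) x⇝y ,
                           dec-true (reach? k x z) (x⇝y ◅◅ return s)
    ; EH-adj  = λ y z yz → proj₁ (proj₂ (proj₂ (dec-true⁻¹ (edge? y z) yz)))
    }
    where
    edge? : ∀ y z → Dec (Reach k x y × Step k y z)
    edge? y z = reach? k x y ×-dec step? k y z

  component-walk : ∀ {k x y z} → Reach k x y → Reach k y z → WalkH G (component k x) y z
  component-walk x⇝y ε       = hereH
  component-walk {k} {x} {y} x⇝y (s ◅ w) =
    stepH (dec-true (reach? k x y ×-dec step? k y _) (x⇝y , s))
          (component-walk (x⇝y ◅◅ return s) w)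

  tight⇒admissible : ∀ {k x} → Tight k x → Σ (SubProd G) λ H → Admissible G H × Eps G H k
  tight⇒admissible {k} {x} (kx , (ontoˡ , ontoʳ) , y , x⇝y , δy≡k) =
    component k x , (connected , (λ u → map₂ member (ontoˡ u)) , λ v → map₂ member (ontoʳ v)) ,
    (y , member x⇝y , δ≡⇒Dist δy≡k) ,
    λ z _ z∈H → ≤δ⇒≤Dist (Reach-gap kx (dec-true⁻¹ (reach? k x z) z∈H))
    where
    member : ∀ {z} → Reach k x z → does (reach? k x z) ≡ true
    member = dec-true (reach? k x _)
    connected : ConnectedH G (component k x)
    connected z z′ z∈H z′∈H =
      let x⇝z = dec-true⁻¹ (reach? k x z) z∈H
      in component-walk x⇝z (reverse Step-sym x⇝z ◅◅ dec-true⁻¹ (reach? k x z′) z′∈H)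

theorem3p5 : (G : Graph) → Fin (Graph.n G) → Connected G →
    ∃ λ M → IsMc G M × IsSpan G M
theorem3p5 G a conn with Levels.greatest-feasible G conn a
... | M , (x , Mx , covers) , maximal =
  M , (tight⇒opposite tight , λ l f g m pair md → maximal m (opposite⇒feasible pair md))
    , (tight⇒admissible tight , λ H e adm eps → maximal e (admissible⇒feasible adm eps))
  where
  open Levels G conn
  tight : Tight M x
  tight = greatest⇒tight maximal Mx covers
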